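{- Let $\overline{P}$ be a Gauss code over $E=\{1,\dots,n\}$ and let $\gamma\in\{0,1\}^E$ be arbitrary. Let $b_\gamma:\mathbb{Z}_2^E\to\mathbb{Z}_2^E$ be the linear map defined on singletons by $b_\gamma(x)=i_{\overline{P}}^2(x)+\sum_{y\in i_{\overline{P}}(x)}(1+\gamma_x+\gamma_y)\,y$, and let $p=\dim\mathrm{Im}(b_\gamma)$ (which equals the connectivity of the surface $S_\gamma$). Then the quadratic system in the $2np$ variables $\delta_{zj},\epsilon_{zj}\in\mathbb{Z}_2$ ($z\in E$, $1\le j\le p$) given by $\sum_{z\in E}\Big(\sum_{j=1}^p\delta_{zj}\epsilon_{xj}\Big)z=i_{\overline{P}}^2(x)+\sum_{y\in i_{\overline{P}}(x)}(1+\gamma_x+\gamma_y)\,y\quad\text{for each }x\in E$ is solvable.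
   Context: A Gauss code over $E=\{1,\dots,n\}$ is a cyclic sequence $\overline{P}$ of length $2n$ in which each element of $E$ occurs twice. Identify subsets of $E$ with vectors in $\mathbb{Z}_2^E$ and $x$ with $\{x\}$. $i_{\overline{P}}$ is the $\mathbb{Z}_2$-linear map with $i_{\overline{P}}(x)$ = set of elements occurring exactly once in $\overline{P}$ strictly between the two occurrences of $x$. Given $\gamma$, $P_\gamma$ is the map with a single vertex whose loops are the elements of $E$, with rotation at the vertex given by $\overline{P}$, the loop $x$ being orientation-reversing iff $\gamma_x=1$; $S_\gamma$ is its surface. The connectivity of a closed surface $S$ is $\dim H_1(S;\mathbb{Z}_2)$. The map $b_\gamma$ coincides with $b_{P_\gamma}=c_{P^\sim}\circ c_P$ for the phial of $P_\gamma$ (a map with a single zigzag), and its rank equals the connectivity of $S_\gamma$. -}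

module Defs where

open import Data.Nat using (ℕ; zero; suc; _+_; _≡ᵇ_)
open import Data.Bool using (Bool; true; false; _∧_; not; _xor_; if_then_else_)
open import Data.Fin using (Fin; zero; suc; _≟_)
open import Data.List using (List; []; _∷_; length)
open import Data.Product using (Σ; _×_; _,_)
open import Relation.Nullary using (yes; no)
open import Relation.Binary.PropositionalEquality using (_≡_)

-- ℤ₂ is Bool with xor as addition and ∧ as multiplication.
-- A vector of ℤ₂^E (E = Fin n) is a function Fin n → Bool (a subset of E).
Vec₂ : ℕ → Set
Vec₂ n = Fin n → Bool

⊕ : {m : ℕ} → (Fin m → Bool) → Bool
⊕ {zero} f = false
⊕ {suc m} f = f zero xor ⊕ (λ j → f (suc j))

_≐_ : {n : ℕ} → Vec₂ n → Vec₂ n → Set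
u ≐ v = ∀ z → u z ≡ v z

count : {n : ℕ} → Fin n → List (Fin n) → ℕ
count x [] = 0
count x (a ∷ as) with a ≟ x
... | yes _ = suc (count x as)
... | no  _ = count x as

-- A Gauss code over E = Fin n, given by a linear representative of the
-- cyclic sequence: a list of length 2n in which each element occurs twice.
record GaussCode (n : ℕ) : Set where
  constructor gauss
  field
    word    : List (Fin n)
    len     : length word ≡ n + n
    twice   : ∀ x → count x word ≡ 2

-- Number of occurrences of y strictly between the (first) two occurrences of x:
-- walk through the word, s = number of occurrences of x seen so far.
betweenCount : {n : ℕ} → Fin n → Fin n → ℕ → List (Fin n) → ℕ
betweenCount x y s [] = 0
betweenCount x y s (a ∷ as) with a ≟ x
... | yes _ = betweenCount x y (suc s) as
... | no  _ with s ≡ᵇ 1 | a ≟ y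
...   | true | yes _ = suc (betweenCount x y s as)
...   | _    | _     = betweenCount x y s as

-- i_P(x) = set of elements occurring exactly once strictly between the two
-- occurrences of x.
iP : {n : ℕ} → GaussCode n → Fin n → Vec₂ n
iP P x y = betweenCount x y 0 (GaussCode.word P) ≡ᵇ 1

linExt : {n : ℕ} → (Fin n → Vec₂ n) → Vec₂ n → Vec₂ n
linExt f v z = ⊕ (λ x → v x ∧ f x z)

iP² : {n : ℕ} → GaussCode n → Fin n → Vec₂ n
iP² P x = linExt (iP P) (iP P x)

bγ-sing : {n : ℕ} → GaussCode n → Vec₂ n → Fin n → Vec₂ n
bγ-sing P γ x z = iP² P x z xor (iP P x z ∧ (true xor γ x xor γ z))

bγ : {n : ℕ} → GaussCode n → Vec₂ n → Vec₂ n → Vec₂ n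
bγ P γ = linExt (bγ-sing P γ)

lincomb : {n p : ℕ} → (Fin p → Bool) → (Fin p → Vec₂ n) → Vec₂ n
lincomb c u z = ⊕ (λ j → c j ∧ u j z)

LinIndep : {n p : ℕ} → (Fin p → Vec₂ n) → Set
LinIndep {n} {p} u = (c : Fin p → Bool) → lincomb c u ≐ (λ _ → false) → ∀ j → c j ≡ false

IsBasisOfImage : {n p : ℕ} → (Vec₂ n → Vec₂ n) → (Fin p → Vec₂ n) → Set
IsBasisOfImage {n} {p} f u =
  LinIndep u ×
  (∀ (v : Vec₂ n) →
     (Σ (Fin p → Bool) (λ c → v ≐ lincomb c u) → Σ (Vec₂ n) (λ w → v ≐ f w)) ×
     (Σ (Vec₂ n) (λ w → v ≐ f w) → Σ (Fin p → Bool) (λ c → v ≐ lincomb c u)))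

DimImage : {n : ℕ} → (Vec₂ n → Vec₂ n) → ℕ → Set
DimImage {n} f p = Σ (Fin p → Vec₂ n) (IsBasisOfImage f)

{-# OPTIONS --safe #-}
-- The system says that the n × n matrix of b_γ factors through ℤ₂^p as δ εᵀ,
-- i.e. it is a rank factorisation.  Each column b_γ(x) = b_γ({x}) lies in
-- Im(b_γ), so it has coordinates ε_x with respect to a basis u_1, …, u_p of
-- the image; taking δ_zj to be the z-th entry of u_j solves the system.
module Submission where

open import Defs
open import Data.Nat using (ℕ; zero; suc)
open import Data.Fin using (Fin; zero; suc)
open import Data.Bool using (Bool; true; false; _∧_; _xor_)
open import Data.Bool.Properties using (∧-comm; xor-identityʳ)
open import Data.Product using (Σ; _,_; proj₁; proj₂)
open import Relation.Binary.PropositionalEquality using (_≡_; refl; sym; trans; cong; cong₂)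
open import Relation.Binary.PropositionalEquality.Properties using (module ≡-Reasoning)

⁅_⁆ : {m : ℕ} → Fin m → Vec₂ m
⁅ zero  ⁆ zero    = true
⁅ zero  ⁆ (suc _) = false
⁅ suc _ ⁆ zero    = false
⁅ suc x ⁆ (suc y) = ⁅ x ⁆ y

⊕-false : {m : ℕ} → ⊕ {m} (λ _ → false) ≡ false
⊕-false {zero}  = refl
⊕-false {suc m} = ⊕-false {m}

⊕-cong : {m : ℕ} {f g : Fin m → Bool} → (∀ j → f j ≡ g j) → ⊕ f ≡ ⊕ g
⊕-cong {zero}  f≗g = refl
⊕-cong {suc m} f≗g = cong₂ _xor_ (f≗g zero) (⊕-cong (λ j → f≗g (suc j)))

⊕-⁅⁆-∧ : {m : ℕ} (x : Fin m) (f : Fin m → Bool) → ⊕ (λ y → ⁅ x ⁆ y ∧ f y) ≡ f x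
⊕-⁅⁆-∧ {suc m} zero f = trans (cong (f zero xor_) (⊕-false {m})) (xor-identityʳ (f zero))
⊕-⁅⁆-∧ (suc x) f = ⊕-⁅⁆-∧ x (λ y → f (suc y))

linExt-⁅⁆ : {n : ℕ} (f : Fin n → Vec₂ n) (x : Fin n) → linExt f ⁅ x ⁆ ≐ f x
linExt-⁅⁆ f x z = ⊕-⁅⁆-∧ x (λ y → f y z)

image-coordinates : {n p : ℕ} {g : Vec₂ n → Vec₂ n} {u : Fin p → Vec₂ n} →
  IsBasisOfImage g u → (w : Vec₂ n) → Σ (Fin p → Bool) (λ c → g w ≐ lincomb c u)
image-coordinates (_ , spans) w = proj₂ (spans _) (w , λ _ → refl)

rank-factorisation : {n p : ℕ} (f : Fin n → Vec₂ n) (u : Fin p → Vec₂ n) →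
  IsBasisOfImage (linExt f) u →
  Σ (Fin n → Fin p → Bool) (λ c → (x z : Fin n) → ⊕ (λ j → u j z ∧ c x j) ≡ f x z)
rank-factorisation {n} {p} f u basis = coordinates , factors
  where
  coordinates : Fin n → Fin p → Bool
  coordinates x = proj₁ (image-coordinates basis ⁅ x ⁆)
  factors : (x z : Fin n) → ⊕ (λ j → u j z ∧ coordinates x j) ≡ f x z
  factors x z = begin
    ⊕ (λ j → u j z ∧ coordinates x j)  ≡⟨ ⊕-cong (λ j → ∧-comm (u j z) (coordinates x j)) ⟩
    lincomb (coordinates x) u z        ≡⟨ sym (proj₂ (image-coordinates basis ⁅ x ⁆) z) ⟩
    linExt f ⁅ x ⁆ z                   ≡⟨ linExt-⁅⁆ f x z ⟩
    f x z                              ∎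
    where open ≡-Reasoning

proposition12 : (n : ℕ) (P : GaussCode n) (γ : Fin n → Bool) (p : ℕ) →
    DimImage (bγ P γ) p →
    Σ (Fin n → Fin p → Bool) (λ δ → Σ (Fin n → Fin p → Bool) (λ ε →
      (x z : Fin n) → ⊕ (λ j → δ z j ∧ ε x j) ≡ bγ-sing P γ x z))
proposition12 n P γ p (u , basis) =
  (λ z j → u j z) , rank-factorisation (bγ-sing P γ) u basis
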